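{- Let $p$ and $q$ be nonzero integers with $p - q = 1$ and $q \neq 1$. Let $(U_n)_{n\ge0}$ and $(V_n)_{n\ge0}$ be defined by $U_0=0$, $U_1=1$, $V_0=2$, $V_1=p$, and $U_n = pU_{n-1}-qU_{n-2}$, $V_n = pV_{n-1}-qV_{n-2}$ for $n\ge2$. Then for all $n \geq 1$, $$\sum_{i=1}^n i\, V_i = n U_{n+1} - \frac{q U_n - n}{q-1} + \binom{n+1}{2}.$$
   Context: $(U_n)$ and $(V_n)$ are the Lucas sequences of the first and second kind with parameters $p,q$. -}

module Defs where

open import Data.Nat as ℕ using (ℕ; zero; suc)
open import Data.Integer as ℤ using (ℤ; +_)
open import Data.Rational as ℚ using (ℚ; NonZero)
open import Relation.Binary.PropositionalEquality using (_≡_; _≢_; cong; refl; sym; trans)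
open import Relation.Nullary using (¬_)

U : ℤ → ℤ → ℕ → ℤ
U p q zero = + 0
U p q (suc zero) = + 1
U p q (suc (suc n)) = p ℤ.* U p q (suc n) ℤ.- q ℤ.* U p q n

V : ℤ → ℤ → ℕ → ℤ
V p q zero = + 2
V p q (suc zero) = p
V p q (suc (suc n)) = p ℤ.* V p q (suc n) ℤ.- q ℤ.* V p q n

sum1 : (ℕ → ℤ) → ℕ → ℤ
sum1 f zero = + 0
sum1 f (suc n) = sum1 f n ℤ.+ f (suc n)

qm1 : ℤ → ℚ
qm1 q = (q ℤ.- + 1) ℚ./ 1

private
  int-nz : (z : ℤ) → z ≢ + 0 → NonZero (z ℚ./ 1)
  int-nz z z≢0 = ℚ.≢-nonZero {z ℚ./ 1} λ e → z≢0 (trans (sym (↥-/ z 1)) (step e))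
    where
      open import Data.Rational.Properties using (↥-/)
      open import Data.Integer.GCD using (gcd)
      step : z ℚ./ 1 ≡ ℚ.0ℚ → ℚ.↥ (z ℚ./ 1) ℤ.* gcd z (+ 1) ≡ + 0
      step e = cong (λ r → ℚ.↥ r ℤ.* gcd z (+ 1)) e

qm1-nonZero : (q : ℤ) → q ≢ + 1 → NonZero (qm1 q)
qm1-nonZero q q≢1 = int-nz (q ℤ.- + 1) λ e → q≢1 (i-j≡0⇒i≡j q (+ 1) e)
  where open import Data.Integer.Properties using (i-j≡0⇒i≡j)

-- For p = 1 + q the characteristic roots of the recurrences are 1 and q, so
-- U (n + 1) = q U n + 1 and V n = (q − 1) U n + 2. The first relation telescopes
-- to (q − 1) (U 1 + ⋯ + U n) = q U n − n; with the second, summation by parts gives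
-- Σ i V i = n U (n + 1) − (U 1 + ⋯ + U n) + C(n + 1, 2). Dividing the former by
-- q − 1 and substituting yields the theorem.
module Submission where

open import Defs
open import Data.Nat as ℕ using (ℕ; suc; zero; _≥_)
open import Data.Nat.Combinatorics using (_C_; nCk+nC[k+1]≡[n+1]C[k+1]; nC1≡n)
import Data.Nat.Properties as ℕP
open import Data.Integer as ℤ using (ℤ; +_)
import Data.Integer.Properties as ℤP
open import Data.Integer.Tactic.RingSolver using (solve-∀)
open import Data.Rational as ℚ using (ℚ; _/_; NonZero)
import Data.Rational.Properties as ℚP
import Data.Rational.Unnormalised as ℚᵘ
import Data.Rational.Unnormalised.Properties as ℚᵘP
open import Relation.Binary.PropositionalEquality

[n+2]C2≡[n+1]C2+[n+1] : ∀ n → suc (suc n) C 2 ≡ suc n C 2 ℕ.+ suc n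
[n+2]C2≡[n+1]C2+[n+1] n = begin
  suc (suc n) C 2          ≡⟨ nCk+nC[k+1]≡[n+1]C[k+1] (suc n) 1 ⟨
  suc n C 1 ℕ.+ suc n C 2  ≡⟨ cong (ℕ._+ suc n C 2) (nC1≡n (suc n)) ⟩
  suc n ℕ.+ suc n C 2      ≡⟨ ℕP.+-comm (suc n) (suc n C 2) ⟩
  suc n C 2 ℕ.+ suc n      ∎
  where open ≡-Reasoning

module UnitDifference (q : ℤ) where

  p : ℤ
  p = + 1 ℤ.+ q

  U-suc : ∀ n → U p q (suc n) ≡ q ℤ.* U p q n ℤ.+ + 1
  U-suc zero    = identity q
    where
    identity : ∀ q → + 1 ≡ q ℤ.* + 0 ℤ.+ + 1
    identity = solve-∀
  U-suc (suc n) = begin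
    p ℤ.* U p q (suc n) ℤ.- q ℤ.* U p q n
      ≡⟨ cong (λ u → p ℤ.* u ℤ.- q ℤ.* U p q n) (U-suc n) ⟩
    p ℤ.* (q ℤ.* U p q n ℤ.+ + 1) ℤ.- q ℤ.* U p q n
      ≡⟨ identity q (U p q n) ⟩
    q ℤ.* (q ℤ.* U p q n ℤ.+ + 1) ℤ.+ + 1
      ≡⟨ cong (λ u → q ℤ.* u ℤ.+ + 1) (U-suc n) ⟨
    q ℤ.* U p q (suc n) ℤ.+ + 1
      ∎
    where
    open ≡-Reasoning
    identity : ∀ q a → (+ 1 ℤ.+ q) ℤ.* (q ℤ.* a ℤ.+ + 1) ℤ.- q ℤ.* a
                       ≡ q ℤ.* (q ℤ.* a ℤ.+ + 1) ℤ.+ + 1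
    identity = solve-∀

  V≡[q-1]U+2 : ∀ n → V p q n ≡ (q ℤ.- + 1) ℤ.* U p q n ℤ.+ + 2
  V≡[q-1]U+2 zero          = identity q
    where
    identity : ∀ q → + 2 ≡ (q ℤ.- + 1) ℤ.* + 0 ℤ.+ + 2
    identity = solve-∀
  V≡[q-1]U+2 (suc zero)    = identity q
    where
    identity : ∀ q → + 1 ℤ.+ q ≡ (q ℤ.- + 1) ℤ.* + 1 ℤ.+ + 2
    identity = solve-∀
  V≡[q-1]U+2 (suc (suc n)) = begin
    p ℤ.* V p q (suc n) ℤ.- q ℤ.* V p q n
      ≡⟨ cong₂ (λ v w → p ℤ.* v ℤ.- q ℤ.* w) (V≡[q-1]U+2 (suc n)) (V≡[q-1]U+2 n) ⟩
    p ℤ.* ((q ℤ.- + 1) ℤ.* U p q (suc n) ℤ.+ + 2) ℤ.- q ℤ.* ((q ℤ.- + 1) ℤ.* U p q n ℤ.+ + 2)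
      ≡⟨ identity q (U p q (suc n)) (U p q n) ⟩
    (q ℤ.- + 1) ℤ.* (p ℤ.* U p q (suc n) ℤ.- q ℤ.* U p q n) ℤ.+ + 2
      ∎
    where
    open ≡-Reasoning
    identity : ∀ q a b →
      (+ 1 ℤ.+ q) ℤ.* ((q ℤ.- + 1) ℤ.* a ℤ.+ + 2) ℤ.- q ℤ.* ((q ℤ.- + 1) ℤ.* b ℤ.+ + 2)
      ≡ (q ℤ.- + 1) ℤ.* ((+ 1 ℤ.+ q) ℤ.* a ℤ.- q ℤ.* b) ℤ.+ + 2
    identity = solve-∀

  [q-1]ΣU≡qU-n : ∀ n → (q ℤ.- + 1) ℤ.* sum1 (U p q) n ≡ q ℤ.* U p q n ℤ.- + n
  [q-1]ΣU≡qU-n zero    = identity q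
    where
    identity : ∀ q → (q ℤ.- + 1) ℤ.* + 0 ≡ q ℤ.* + 0 ℤ.- + 0
    identity = solve-∀
  [q-1]ΣU≡qU-n (suc n) = begin
    (q ℤ.- + 1) ℤ.* (sum1 (U p q) n ℤ.+ U p q (suc n))
      ≡⟨ ℤP.*-distribˡ-+ (q ℤ.- + 1) (sum1 (U p q) n) (U p q (suc n)) ⟩
    (q ℤ.- + 1) ℤ.* sum1 (U p q) n ℤ.+ (q ℤ.- + 1) ℤ.* U p q (suc n)
      ≡⟨ cong₂ ℤ._+_ ([q-1]ΣU≡qU-n n) (cong ((q ℤ.- + 1) ℤ.*_) (U-suc n)) ⟩
    q ℤ.* U p q n ℤ.- + n ℤ.+ (q ℤ.- + 1) ℤ.* (q ℤ.* U p q n ℤ.+ + 1)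
      ≡⟨ identity q (U p q n) (+ n) ⟩
    q ℤ.* (q ℤ.* U p q n ℤ.+ + 1) ℤ.- + suc n
      ≡⟨ cong (λ u → q ℤ.* u ℤ.- + suc n) (U-suc n) ⟨
    q ℤ.* U p q (suc n) ℤ.- + suc n
      ∎
    where
    open ≡-Reasoning
    identity : ∀ q a m → q ℤ.* a ℤ.- m ℤ.+ (q ℤ.- + 1) ℤ.* (q ℤ.* a ℤ.+ + 1)
                         ≡ q ℤ.* (q ℤ.* a ℤ.+ + 1) ℤ.- (+ 1 ℤ.+ m)
    identity = solve-∀

  ΣiV≡nU-ΣU+C : ∀ n → sum1 (λ i → + i ℤ.* V p q i) n
                      ≡ + n ℤ.* U p q (suc n) ℤ.- sum1 (U p q) n ℤ.+ + (suc n C 2)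
  ΣiV≡nU-ΣU+C zero    = refl
  ΣiV≡nU-ΣU+C (suc n) = begin
    sum1 (λ i → + i ℤ.* V p q i) n ℤ.+ + suc n ℤ.* V p q (suc n)
      ≡⟨ cong₂ ℤ._+_ (ΣiV≡nU-ΣU+C n) (cong (+ suc n ℤ.*_) (V≡[q-1]U+2 (suc n))) ⟩
    + n ℤ.* u ℤ.- σ ℤ.+ c ℤ.+ + suc n ℤ.* ((q ℤ.- + 1) ℤ.* u ℤ.+ + 2)
      ≡⟨ identity q (+ n) u σ c ⟩
    + suc n ℤ.* (q ℤ.* u ℤ.+ + 1) ℤ.- (σ ℤ.+ u) ℤ.+ (c ℤ.+ + suc n)
      ≡⟨ cong₂ (λ w c′ → + suc n ℤ.* w ℤ.- (σ ℤ.+ u) ℤ.+ c′)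
               (U-suc (suc n)) (cong +_ ([n+2]C2≡[n+1]C2+[n+1] n)) ⟨
    + suc n ℤ.* U p q (suc (suc n)) ℤ.- (σ ℤ.+ u) ℤ.+ + (suc (suc n) C 2)
      ∎
    where
    open ≡-Reasoning
    u σ c : ℤ
    u = U p q (suc n)
    σ = sum1 (U p q) n
    c = + (suc n C 2)
    identity : ∀ q m u σ c →
      m ℤ.* u ℤ.- σ ℤ.+ c ℤ.+ (+ 1 ℤ.+ m) ℤ.* ((q ℤ.- + 1) ℤ.* u ℤ.+ + 2)
      ≡ (+ 1 ℤ.+ m) ℤ.* (q ℤ.* u ℤ.+ + 1) ℤ.- (σ ℤ.+ u) ℤ.+ (c ℤ.+ (+ 1 ℤ.+ m))
    identity = solve-∀

-- i / 1 is definitionally fromℚᵘ (mkℚᵘ i 0).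
toℚᵘ-/1 : ∀ i → ℚ.toℚᵘ (i / 1) ℚᵘ.≃ ℚᵘ.mkℚᵘ i 0
toℚᵘ-/1 i = ℚP.toℚᵘ-fromℚᵘ (ℚᵘ.mkℚᵘ i 0)

/1-homo-+ : ∀ i j → (i ℤ.+ j) / 1 ≡ i / 1 ℚ.+ j / 1
/1-homo-+ i j = ℚP.toℚᵘ-injective (begin
  ℚ.toℚᵘ ((i ℤ.+ j) / 1)                 ≈⟨ toℚᵘ-/1 (i ℤ.+ j) ⟩
  ℚᵘ.mkℚᵘ (i ℤ.+ j) 0                    ≈⟨ ℚᵘ.*≡* (identity i j) ⟩
  ℚᵘ.mkℚᵘ i 0 ℚᵘ.+ ℚᵘ.mkℚᵘ j 0           ≈⟨ ℚᵘP.+-cong (toℚᵘ-/1 i) (toℚᵘ-/1 j) ⟨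
  ℚ.toℚᵘ (i / 1) ℚᵘ.+ ℚ.toℚᵘ (j / 1)     ≈⟨ ℚP.toℚᵘ-homo-+ (i / 1) (j / 1) ⟨
  ℚ.toℚᵘ (i / 1 ℚ.+ j / 1)               ∎)
  where
  open ℚᵘP.≃-Reasoning
  identity : ∀ i j → (i ℤ.+ j) ℤ.* + 1 ≡ (i ℤ.* + 1 ℤ.+ j ℤ.* + 1) ℤ.* + 1
  identity = solve-∀

/1-homo-* : ∀ i j → (i ℤ.* j) / 1 ≡ (i / 1) ℚ.* (j / 1)
/1-homo-* i j = ℚP.toℚᵘ-injective (begin
  ℚ.toℚᵘ ((i ℤ.* j) / 1)                 ≈⟨ toℚᵘ-/1 (i ℤ.* j) ⟩
  ℚᵘ.mkℚᵘ i 0 ℚᵘ.* ℚᵘ.mkℚᵘ j 0           ≈⟨ ℚᵘP.*-cong (toℚᵘ-/1 i) (toℚᵘ-/1 j) ⟨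
  ℚ.toℚᵘ (i / 1) ℚᵘ.* ℚ.toℚᵘ (j / 1)     ≈⟨ ℚP.toℚᵘ-homo-* (i / 1) (j / 1) ⟨
  ℚ.toℚᵘ ((i / 1) ℚ.* (j / 1))               ∎)
  where open ℚᵘP.≃-Reasoning

/1-homo-neg : ∀ i → (ℤ.- i) / 1 ≡ ℚ.- (i / 1)
/1-homo-neg i = ℚP.toℚᵘ-injective (begin
  ℚ.toℚᵘ ((ℤ.- i) / 1)         ≈⟨ toℚᵘ-/1 (ℤ.- i) ⟩
  ℚᵘ.- ℚᵘ.mkℚᵘ i 0             ≈⟨ ℚᵘP.-‿cong (toℚᵘ-/1 i) ⟨
  ℚᵘ.- ℚ.toℚᵘ (i / 1)          ≈⟨ ℚP.toℚᵘ-homo‿- (i / 1) ⟨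
  ℚ.toℚᵘ (ℚ.- (i / 1))         ∎)
  where open ℚᵘP.≃-Reasoning

/1-homo-- : ∀ i j → (i ℤ.- j) / 1 ≡ i / 1 ℚ.- j / 1
/1-homo-- i j = trans (/1-homo-+ i (ℤ.- j)) (cong (i / 1 ℚ.+_) (/1-homo-neg j))

*/1÷/1 : ∀ d w .{{_ : NonZero (d / 1)}} → ((d ℤ.* w) / 1) ℚ.÷ (d / 1) ≡ w / 1
*/1÷/1 d w = begin
  (d ℤ.* w) / 1 ℚ.* ℚ.1/ δ        ≡⟨ cong (ℚ._* ℚ.1/ δ) (/1-homo-* d w) ⟩
  δ ℚ.* ω ℚ.* ℚ.1/ δ              ≡⟨ cong (ℚ._* ℚ.1/ δ) (ℚP.*-comm δ ω) ⟩
  ω ℚ.* δ ℚ.* ℚ.1/ δ              ≡⟨ ℚP.*-assoc ω δ (ℚ.1/ δ) ⟩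
  ω ℚ.* (δ ℚ.* ℚ.1/ δ)            ≡⟨ cong (ω ℚ.*_) (ℚP.*-inverseʳ δ) ⟩
  ω ℚ.* ℚ.1ℚ                      ≡⟨ ℚP.*-identityʳ ω ⟩
  ω                               ∎
  where
  open ≡-Reasoning
  δ ω : ℚ
  δ = d / 1
  ω = w / 1

i-j≡1⇒i≡1+j : ∀ i j → i ℤ.- j ≡ + 1 → i ≡ + 1 ℤ.+ j
i-j≡1⇒i≡1+j i j i-j≡1 = trans (identity i j) (cong (ℤ._+ j) i-j≡1)
  where
  identity : ∀ i j → i ≡ i ℤ.- j ℤ.+ j
  identity = solve-∀

theorem4p5 : (p q : ℤ) → p ≢ + 0 → q ≢ + 0 → p ℤ.- q ≡ + 1 → (q≢1 : q ≢ + 1) →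
    (n : ℕ) → n ≥ 1 →
    sum1 (λ i → + i ℤ.* V p q i) n / 1
      ≡ (+ n ℤ.* U p q (suc n)) / 1
        ℚ.- ((((q ℤ.* U p q n ℤ.- + n) / 1) ℚ.÷ qm1 q) {{qm1-nonZero q q≢1}})
        ℚ.+ (+ (suc n C 2)) / 1
theorem4p5 p q _ _ p-q≡1 q≢1 n _ with i-j≡1⇒i≡1+j p q p-q≡1
... | refl = begin
  sum1 (λ i → + i ℤ.* V p q i) n / 1
    ≡⟨ cong (_/ 1) (ΣiV≡nU-ΣU+C n) ⟩
  (nU ℤ.- σ ℤ.+ c) / 1
    ≡⟨ trans (/1-homo-+ (nU ℤ.- σ) c) (cong (ℚ._+ c / 1) (/1-homo-- nU σ)) ⟩
  nU / 1 ℚ.- σ / 1 ℚ.+ c / 1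
    ≡⟨ cong (λ x → nU / 1 ℚ.- x ℚ.+ c / 1) σ≡[qU-n]/[q-1] ⟩
  nU / 1 ℚ.- ((q ℤ.* U p q n ℤ.- + n) / 1) ℚ.÷ qm1 q ℚ.+ c / 1
    ∎
  where
  open ≡-Reasoning
  open UnitDifference q using (ΣiV≡nU-ΣU+C; [q-1]ΣU≡qU-n)
  instance
    q-1≢0 : NonZero (qm1 q)
    q-1≢0 = qm1-nonZero q q≢1
  nU σ c : ℤ
  nU = + n ℤ.* U p q (suc n)
  σ  = sum1 (U p q) n
  c  = + (suc n C 2)
  σ≡[qU-n]/[q-1] : σ / 1 ≡ ((q ℤ.* U p q n ℤ.- + n) / 1) ℚ.÷ qm1 q
  σ≡[qU-n]/[q-1] = begin
    σ / 1                                          ≡⟨ */1÷/1 (q ℤ.- + 1) σ ⟨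
    ((q ℤ.- + 1) ℤ.* σ) / 1 ℚ.÷ qm1 q             ≡⟨ cong (λ z → z / 1 ℚ.÷ qm1 q) ([q-1]ΣU≡qU-n n) ⟩
    ((q ℤ.* U p q n ℤ.- + n) / 1) ℚ.÷ qm1 q       ∎
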